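{- Let $\mathfrak{R}$ be either $\mathbb{F}_q$ ($q$ a prime power) or $\mathbb{Z}_k$ ($k\ge2$), let $g,n$ be positive integers, and let $C$ be an $\mathfrak{R}$-linear code of length $n$. Then: (1) Substituting $x_0\leftarrow 1$ and, for each $0\neq a\in\mathfrak{R}^g$, $x_a\leftarrow \prod_{K\subset\mathrm{Vsupp}(a),\,K\neq\emptyset} X_{K,a_K}$ into $W_C^{(g)}$ yields $I_C^{(g)}$. (2) As rational functions in the $x_a$, \[ x_0^n\, I_C^{(g)}\Big(X_{K,L}\leftarrow \prod_{K'\subset K} x_{L_{K'}}^{(-1)^{|K|-|K'|}}\Big)=W_C^{(g)}, \] where the substitution is made for all $1\le p\le g$, $K=(K_1,\ldots,K_p)\in\binom{[g]}{p}$, $L=(L_1,\ldots,L_p)\in(\mathfrak{R}^\ast)^p$.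
   Context: $\mathfrak{R}^\ast=\mathfrak{R}\setminus\{0\}$. An $\mathfrak{R}$-linear code of length $n$ is a subspace (if $\mathfrak{R}=\mathbb{F}_q$) or submodule (if $\mathfrak{R}=\mathbb{Z}_k$) of $\mathfrak{R}^n$. $[g]=\{1,\ldots,g\}$; $\binom{[g]}{p}$ is the set of tuples $K=(K_1,\ldots,K_p)$ of integers with $1\le K_1<\cdots<K_p\le g$, and $|K|=p$. For $w_1,\ldots,w_m\in\mathfrak{R}^n$ and $c\in\mathfrak{R}^m$, $n_c(w_1,\ldots,w_m)=\#\{i: (w_{1,i},\ldots,w_{m,i})=c\}$. The $g$-th weight enumerator is $W_C^{(g)}=\sum_{u_1,\ldots,u_g\in C}\prod_{a\in\mathfrak{R}^g}x_a^{n_a(u_1,\ldots,u_g)}$ (the $u_i$ range independently over $C$, repetitions allowed), in indeterminates $x_a$, $a\in\mathfrak{R}^g$. The $g$-th intersection enumerator is $I_C^{(g)}=\sum_{u_1,\ldots,u_g\in C}\prod_{1\le p\le g}\prod_{K\in\binom{[g]}{p}}\prod_{L\in(\mathfrak{R}^\ast)^p}X_{K,L}^{n_L(u_{K_1},\ldots,u_{K_p})}$, in indeterminates $X_{K,L}$. For $a\in\mathfrak{R}^g$, $\mathrm{Vsupp}(a)$ is the increasing tuple of indices $i$ with $a_i\ne0$; "$K\subset K''$" for increasing tuples means $K$ is a subtuple (possibly empty, written $\emptyset$); $a_K=(a_{K_1},\ldots,a_{K_{|K|}})$. In (2), for $K'=(K_{m_1},\ldots,K_{m_r})\subset K$ (with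 $m_1<\cdots<m_r$), $L_{K'}$ is the length-$g$ vector whose entry at position $K_{m_j}$ is $L_{m_j}$ (the entry of $L$ attached to the index $K_{m_j}$) for $1\le j\le r$ and whose other entries are $0$; $L_\emptyset=0$. -}

module Defs where

open import Level using (0ℓ)
open import Data.Bool using (Bool; true; false; T; _∧_; not; if_then_else_)
open import Data.Nat as ℕ using (ℕ; zero; suc; _≤_; _≤ᵇ_; NonZero)
open import Data.Nat.DivMod using (_mod_)
open import Data.Fin as Fin using (Fin; toℕ) renaming (_≟_ to _≟F_)
open import Data.Fin.Properties using () 
open import Data.Integer as ℤ using (ℤ; +_)
open import Data.Vec as Vec using (Vec; []; _∷_; lookup; replicate; zipWith; allFin)
import Data.Vec.Properties as VecP
open import Data.List as List using (List; []; _∷_; concatMap; filter; mapMaybe; upTo; foldr)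
open import Data.List.Membership.Propositional using (_∈_)
open import Data.List.Relation.Unary.Unique.Propositional using (Unique)
open import Data.Maybe using (Maybe; just; nothing)
open import Data.Product using (Σ; ∃; _,_; _×_)
open import Relation.Nullary using (¬_; Dec; yes; no; does)
open import Relation.Nullary.Decidable using (T?)
open import Relation.Unary using (Decidable)
open import Relation.Binary using (DecidableEquality; Setoid)
open import Relation.Binary.PropositionalEquality using (_≡_; _≢_; refl; _→-setoid_)
open import Algebra.Core using (Op₁; Op₂)
open import Algebra.Structures using (IsCommutativeRing)
import Data.List.Relation.Binary.Permutation.Setoid as PermS

record FinRing : Set₁ where
  field
    Carrier  : Set
    _≟_      : DecidableEquality Carrier
    0# 1#    : Carrier
    _+_ _*_  : Op₂ Carrier
    -_       : Op₁ Carrier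
    elements : List Carrier      -- enumeration of all elements, each once

record FiniteField : Set₁ where
  field
    ring : FinRing
  open FinRing ring
  field
    isCommutativeRing : IsCommutativeRing _≡_ _+_ _*_ -_ 0# 1#
    0≢1      : 0# ≢ 1#
    inverse  : ∀ x → x ≢ 0# → ∃ λ y → x * y ≡ 1#
    complete : ∀ x → x ∈ elements
    unique   : Unique elements

ℤmod : (k : ℕ) .{{_ : NonZero k}} → FinRing
ℤmod k = record
  { Carrier  = Fin k
  ; _≟_      = _≟F_
  ; 0#       = 0 mod k
  ; 1#       = 1 mod k
  ; _+_      = λ a b → (toℕ a ℕ.+ toℕ b) mod k
  ; _*_      = λ a b → (toℕ a ℕ.* toℕ b) mod k
  ; -_       = λ a → (k ℕ.∸ toℕ a) mod k
  ; elements = Vec.toList (allFin k)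
  }

data Alphabet : Set₁ where
  𝔽 : FiniteField → Alphabet
  ℤ/ : (k : ℕ) → 2 ≤ k → Alphabet

ringOf : Alphabet → FinRing
ringOf (𝔽 F) = FiniteField.ring F
ringOf (ℤ/ (suc k) _) = ℤmod (suc k)
ringOf (ℤ/ zero ())

module _ (R : FinRing) where
  open FinRing R

  record LinearCode (n : ℕ) : Set₁ where
    field
      inC   : Vec Carrier n → Set
      inC?  : Decidable inC
      0∈C   : inC (replicate n 0#)
      +∈C   : ∀ {u v} → inC u → inC v → inC (zipWith _+_ u v)
      ·∈C   : ∀ (c : Carrier) {u} → inC u → inC (Vec.map (c *_) u)

allVecs : ∀ {A : Set} → List A → (m : ℕ) → List (Vec A m)
allVecs xs zero    = [] ∷ []
allVecs xs (suc m) = concatMap (λ x → List.map (x ∷_) (allVecs xs m)) xs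

∑ : ∀ {A : Set} → List A → (A → ℤ) → ℤ
∑ xs f = foldr (λ x s → f x ℤ.+ s) (+ 0) xs

-- Laurent monomials over a set V of indeterminates (exponent vectors),
-- and polynomials with ℕ coefficients as finite lists (multisets) of
-- monomials.  Two such (Laurent) polynomials are equal iff the lists are
-- permutations of one another, monomials compared by exponent vector.

Mon : Set → Set
Mon V = V → ℤ

one : ∀ {V} → Mon V
one _ = + 0

_·_ : ∀ {V} → Mon V → Mon V → Mon V
(m · m') v = m v ℤ.+ m' v

_^^_ : ∀ {V} → Mon V → ℤ → Mon V
(m ^^ e) v = e ℤ.* m v

∏ : ∀ {A V : Set} → List A → (A → Mon V) → Mon V
∏ xs f = foldr (λ x m → f x · m) one xs

var : ∀ {V} → DecidableEquality V → V → Mon V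
var _≟_ v w with v ≟ w
... | yes _ = + 1
... | no  _ = + 0

Poly : Set → Set
Poly V = List (Mon V)

_≋_ : ∀ {V} → Poly V → Poly V → Set
_≋_ {V} = PermS._↭_ (V →-setoid ℤ)

substMon : ∀ {V V'} → List V → (V → Mon V') → Mon V → Mon V'
substMon vs σ m = ∏ vs (λ v → σ v ^^ m v)

substPoly : ∀ {V V'} → List V → (V → Mon V') → Poly V → Poly V'
substPoly vs σ = List.map (substMon vs σ)

module Enumerators (R : FinRing) where
  open FinRing R

  isZero : Carrier → Bool
  isZero a = does (a ≟ 0#)

  WVar : ℕ → Set
  WVar g = Vec Carrier g

  _≟W_ : ∀ {g} → DecidableEquality (WVar g)
  _≟W_ = VecP.≡-dec _≟_

  allWVars : (g : ℕ) → List (WVar g)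
  allWVars g = allVecs elements g

  increasing : ∀ {g p} → Vec (Fin g) p → Bool
  increasing []           = true
  increasing (i ∷ [])     = true
  increasing (i ∷ j ∷ is) = (toℕ i ℕ.<ᵇ toℕ j) ∧ increasing (j ∷ is)

  allNonzero : ∀ {p} → Vec Carrier p → Bool
  allNonzero []       = true
  allNonzero (a ∷ as) = not (isZero a) ∧ allNonzero as

  record IVar (g : ℕ) : Set where
    constructor X
    field
      p     : ℕ
      K     : Vec (Fin g) p
      L     : Vec Carrier p
      {p≥1} : T (1 ≤ᵇ p)
      {Kinc}  : T (increasing K)
      {Lnz}   : T (allNonzero L)

  mkIVar : ∀ {g} p → Vec (Fin g) p → Vec Carrier p → Maybe (IVar g)
  mkIVar p K L with T? (1 ≤ᵇ p) | T? (increasing K) | T? (allNonzero L)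
  ... | yes a | yes b | yes c = just (X p K L {a} {b} {c})
  ... | _     | _     | _     = nothing

  allIVars : (g : ℕ) → List (IVar g)
  allIVars g = concatMap (λ p →
                 concatMap (λ K →
                   mapMaybe (mkIVar p K) (allVecs elements p))
                   (allVecs (Vec.toList (allFin g)) p))
               (upTo (suc g))

  nc : ∀ {n m} → Vec (Vec Carrier n) m → Vec Carrier m → ℕ
  nc {n} ws c = List.length
    (filter (λ i → VecP.≡-dec _≟_ (Vec.map (λ w → lookup w i) ws) c)
            (Vec.toList (allFin n)))

  module _ {n : ℕ} (C : LinearCode R n) where
    open LinearCode C

    codewords : List (Vec Carrier n)
    codewords = filter inC? (allVecs elements n)

    tuples : (g : ℕ) → List (Vec (Vec Carrier n) g)
    tuples g = allVecs codewords g

    W : (g : ℕ) → Poly (WVar g)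
    W g = List.map (λ us a → + nc us a) (tuples g)

    I : (g : ℕ) → Poly (IVar g)
    I g = List.map (λ us v → + nc (Vec.map (lookup us) (IVar.K v)) (IVar.L v))
                   (tuples g)

  ⊂Vsupp : ∀ {g p} → Vec (Fin g) p → Vec Carrier g → Bool
  ⊂Vsupp []       a = true
  ⊂Vsupp (k ∷ ks) a = not (isZero (lookup a k)) ∧ ⊂Vsupp ks a

  restrict : ∀ {g p} → Vec Carrier g → Vec (Fin g) p → Vec Carrier p
  restrict a K = Vec.map (lookup a) K

  -- The monomial ∏_{K ⊂ Vsupp(a), K ≠ ∅} X_{K,a_K}: its exponent at
  -- X_{K',L'} is the number of nonempty K ⊂ Vsupp(a) with (K,a_K) = (K',L'),
  -- i.e. 1 if K' ⊂ Vsupp(a) and a_{K'} = L', and 0 otherwise.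
  suppProd : ∀ {g} → Vec Carrier g → Mon (IVar g)
  suppProd a (X p K L) =
    if ⊂Vsupp K a ∧ does (VecP.≡-dec _≟_ (restrict a K) L) then + 1 else + 0

  σ₁ : ∀ {g} → WVar g → Mon (IVar g)
  σ₁ {g} a with a ≟W replicate g 0#
  ... | yes _ = one
  ... | no  _ = suppProd a

  -- subtuples K' ⊂ K are given by a choice s ∈ Bool^p of kept positions
  size : ∀ {p} → Vec Bool p → ℕ
  size []           = 0
  size (true  ∷ s)  = suc (size s)
  size (false ∷ s)  = size s

  Lsub : ∀ {g p} → Vec (Fin g) p → Vec Carrier p → Vec Bool p → Vec Carrier g
  Lsub {g} []       []       []      = replicate g 0#
  Lsub     (k ∷ K) (l ∷ L) (true  ∷ s) = Vec.updateAt (Lsub K L s) k (λ _ → l)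
  Lsub     (k ∷ K) (l ∷ L) (false ∷ s) = Lsub K L s

  sign : ℕ → ℤ
  sign zero          = + 1
  sign (suc zero)    = ℤ.- (+ 1)
  sign (suc (suc m)) = sign m

  σ₂ : ∀ {g} → IVar g → Mon (WVar g)
  σ₂ (X p K L) = ∏ (allVecs (true ∷ false ∷ []) p)
                   (λ s → var _≟W_ (Lsub K L s) ^^ sign (p ℕ.∸ size s))

-- Both identities hold monomial by monomial, i.e. separately for every g-tuple of
-- words, and every exponent is a
-- sum over the n columns c ∈ R^g of the tuple.
-- (1) The exponent of X_{K,L} in σ₁(x_c) is [c_K = L], and summing over the columns
--     gives n_L(u_{K_1}, …, u_{K_p}).
-- (2) A column c contributes x_0 ∏_{∅ ≠ K ⊂ Vsupp c} X_{K,c_K} to the monomial of I.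
--     Under σ₂ the exponent of x_b in it becomes Σ_{K ⊂ [g]} ψ(K), where
--       ψ(K) = ∏_{j ∈ K} [c_j ≠ 0] ([c_j = b_j] − [0 = b_j]) · ∏_{j ∉ K} [0 = b_j]
--     (the term K = ∅ being x_0), and this sum factors as ∏_j [c_j = b_j] = [c = b].
module Submission where

open import Defs
open import Data.Nat using (ℕ; _≤_)
open import Data.Vec using (replicate)
open import Data.Integer using (+_)
open import Data.List using (map)
open import Data.Product using (_×_)

open import Data.Bool using (Bool; true; false; T; not; _∧_)
open import Data.Bool.Properties using (T-∧; T-≡; ∧-zeroʳ)
open import Data.Empty using (⊥-elim)
open import Data.Fin as Fin using (Fin)
import Data.Fin.Properties as Fin
open import Data.Fin.Subset using (Subset)
open import Data.Integer as ℤ using (ℤ; +0; _+_; _*_; -_; _-_)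
import Data.Integer.Properties as ℤ
open import Algebra.Properties.CommutativeSemigroup ℤ.+-commutativeSemigroup
  using (interchange)
open import Algebra.Properties.CommutativeSemigroup ℤ.*-commutativeSemigroup
  using (x∙yz≈y∙xz)
open import Data.Integer.Tactic.RingSolver using (solve-∀)
open import Data.List as List using (List; []; _∷_; _++_; concatMap; filter; mapMaybe; upTo)
import Data.List.Properties as List
open import Data.List.Membership.Propositional using (_∈_)
open import Data.List.Membership.Propositional.Properties using (∈-allFin; ∈-upTo⁺)
open import Data.List.Relation.Binary.Pointwise using (Pointwise; []; _∷_)
import Data.List.Relation.Binary.Permutation.Setoid as Perm
open import Data.List.Relation.Unary.All as All using (All; []; _∷_)
open import Data.List.Relation.Unary.AllPairs using ([]; _∷_)
open import Data.List.Relation.Unary.Any using (here; there)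
open import Data.List.Relation.Unary.Unique.Propositional using (Unique)
open import Data.List.Relation.Unary.Unique.Propositional.Properties using (allFin⁺; upTo⁺)
open import Data.Maybe using (Maybe; just; nothing; maybe′)
open import Data.Nat as ℕ using (zero; suc; _∸_; _<_; _≤ᵇ_)
import Data.Nat.Properties as ℕ
open import Data.Product using (Σ; _,_; proj₁; proj₂)
open import Data.Product.Properties using (,-injectiveˡ; ,-injectiveʳ-UIP; ≡-dec)
open import Data.Vec as Vec using (Vec; []; _∷_; lookup)
import Data.Vec.Properties as Vec
open import Function using (_∘_; Equivalence)
open Equivalence using (to)
open import Relation.Binary using (DecidableEquality)
open import Relation.Binary.PropositionalEquality
open import Relation.Nullary using (¬_; yes; no; does)
open import Relation.Nullary.Decidable using (T?; dec-true)
open import Relation.Unary using (Decidable)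

private
  variable
    A B V : Set
    g m n p : ℕ

¬T⇒≡false : ∀ {b} → ¬ T b → b ≡ false
¬T⇒≡false {true}  ¬t = ⊥-elim (¬t _)
¬T⇒≡false {false} _  = refl

when : Bool → ℤ → ℤ
when true  x = x
when false _ = +0

when-T : ∀ {b} {x} → T b → when b x ≡ x
when-T {true} _ = refl

when-¬T : ∀ {b} {x} → ¬ T b → when b x ≡ +0
when-¬T {true}  ¬t = ⊥-elim (¬t _)
when-¬T {false} _  = refl

when-*ʳ : ∀ b x y → when b (x * y) ≡ x * when b y
when-*ʳ true  x y = refl
when-*ʳ false x y = sym (ℤ.*-zeroʳ x)

when-∧ : ∀ a b x → when (a ∧ b) x ≡ when a (when b x)
when-∧ true  b x = refl
when-∧ false b x = refl

when-∧-* : ∀ a b x y → when (a ∧ b) (x * y) ≡ when a x * when b y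
when-∧-* true  b x y = when-*ʳ b x y
when-∧-* false b x y = refl

var-refl : (_≟_ : DecidableEquality A) (x : A) → var _≟_ x x ≡ + 1
var-refl _≟_ x with x ≟ x
... | yes _  = refl
... | no x≢x = ⊥-elim (x≢x refl)

var-≢ : (_≟_ : DecidableEquality A) {x y : A} → x ≢ y → var _≟_ x y ≡ +0
var-≢ _≟_ {x} {y} x≢y with x ≟ y
... | yes x≡y = ⊥-elim (x≢y x≡y)
... | no _    = refl

var-when : (_≟_ : DecidableEquality A) (x y : A) → var _≟_ x y ≡ when (does (x ≟ y)) (+ 1)
var-when _≟_ x y with x ≟ y
... | yes _ = refl
... | no _  = refl

∑-cong : (xs : List A) {f h : A → ℤ} → (∀ x → f x ≡ h x) → ∑ xs f ≡ ∑ xs h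
∑-cong []       f≡h = refl
∑-cong (x ∷ xs) f≡h = cong₂ _+_ (f≡h x) (∑-cong xs f≡h)

∑-zero : (xs : List A) {f : A → ℤ} → (∀ x → f x ≡ +0) → ∑ xs f ≡ +0
∑-zero []       f≡0 = refl
∑-zero (x ∷ xs) f≡0 = trans (cong₂ _+_ (f≡0 x) (∑-zero xs f≡0)) (ℤ.+-identityˡ _)

∑-+ : (xs : List A) (f h : A → ℤ) → ∑ xs (λ x → f x + h x) ≡ ∑ xs f + ∑ xs h
∑-+ []       f h = refl
∑-+ (x ∷ xs) f h = trans (cong (_+_ (f x + h x)) (∑-+ xs f h)) (interchange (f x) (h x) _ _)

∑-*ˡ : (xs : List A) (k : ℤ) (f : A → ℤ) → ∑ xs (λ x → k * f x) ≡ k * ∑ xs f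
∑-*ˡ []       k f = sym (ℤ.*-zeroʳ k)
∑-*ˡ (x ∷ xs) k f = trans (cong (_+_ (k * f x)) (∑-*ˡ xs k f)) (sym (ℤ.*-distribˡ-+ k (f x) _))

∑-scale : (xs : List A) (k : ℤ) {f h : A → ℤ} → (∀ x → f x ≡ k * h x) → ∑ xs f ≡ k * ∑ xs h
∑-scale xs k {h = h} f≡kh = trans (∑-cong xs f≡kh) (∑-*ˡ xs k h)

∑-*ʳ : (xs : List A) (k : ℤ) (f : A → ℤ) → ∑ xs (λ x → f x * k) ≡ ∑ xs f * k
∑-*ʳ xs k f = begin
  ∑ xs (λ x → f x * k) ≡⟨ ∑-cong xs (λ x → ℤ.*-comm (f x) k) ⟩
  ∑ xs (λ x → k * f x) ≡⟨ ∑-*ˡ xs k f ⟩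
  k * ∑ xs f           ≡⟨ ℤ.*-comm k _ ⟩
  ∑ xs f * k           ∎
  where open ≡-Reasoning

∑-swap : (xs : List A) (ys : List B) (f : A → B → ℤ) →
         ∑ xs (λ x → ∑ ys (f x)) ≡ ∑ ys (λ y → ∑ xs (λ x → f x y))
∑-swap []       ys f = sym (∑-zero ys (λ _ → refl))
∑-swap (x ∷ xs) ys f =
  trans (cong (_+_ (∑ ys (f x))) (∑-swap xs ys f)) (sym (∑-+ ys (f x) _))

∑-const : (xs : List A) (k : ℤ) → ∑ xs (λ _ → k) ≡ + List.length xs * k
∑-const []       k = refl
∑-const (_ ∷ xs) k = trans (cong (_+_ k) (∑-const xs k)) (lemma k (+ List.length xs))
  where
  lemma : ∀ k a → k + a * k ≡ (+ 1 + a) * k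
  lemma = solve-∀

∑-++ : (xs ys : List A) (f : A → ℤ) → ∑ (xs ++ ys) f ≡ ∑ xs f + ∑ ys f
∑-++ []       ys f = sym (ℤ.+-identityˡ _)
∑-++ (x ∷ xs) ys f = trans (cong (_+_ (f x)) (∑-++ xs ys f)) (sym (ℤ.+-assoc (f x) _ _))

∑-map : (xs : List A) (h : A → B) (f : B → ℤ) → ∑ (List.map h xs) f ≡ ∑ xs (f ∘ h)
∑-map []       h f = refl
∑-map (x ∷ xs) h f = cong (_+_ (f (h x))) (∑-map xs h f)

∑-concatMap : (xs : List A) (h : A → List B) (f : B → ℤ) →
              ∑ (concatMap h xs) f ≡ ∑ xs (λ x → ∑ (h x) f)
∑-concatMap []       h f = refl
∑-concatMap (x ∷ xs) h f =
  trans (∑-++ (h x) (concatMap h xs) f) (cong (_+_ (∑ (h x) f)) (∑-concatMap xs h f))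

∑-mapMaybe : (xs : List A) (h : A → Maybe B) (f : B → ℤ) →
             ∑ (mapMaybe h xs) f ≡ ∑ xs (λ x → maybe′ f +0 (h x))
∑-mapMaybe []       h f = refl
∑-mapMaybe (x ∷ xs) h f with h x
... | just y  = cong (_+_ (f y)) (∑-mapMaybe xs h f)
... | nothing = trans (∑-mapMaybe xs h f) (sym (ℤ.+-identityˡ _))

∑-count : {P : A → Set} (P? : Decidable P) (xs : List A) →
          + List.length (filter P? xs) ≡ ∑ xs (λ x → when (does (P? x)) (+ 1))
∑-count P? []       = refl
∑-count P? (x ∷ xs) with does (P? x)
... | true  = cong (_+_ (+ 1)) (∑-count P? xs)
... | false = trans (∑-count P? xs) (sym (ℤ.+-identityˡ _))

∑-allVecs-suc : (E : List A) (m : ℕ) (f : Vec A (suc m) → ℤ) →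
                ∑ (allVecs E (suc m)) f ≡ ∑ E (λ x → ∑ (allVecs E m) (f ∘ (x ∷_)))
∑-allVecs-suc E m f = trans (∑-concatMap E _ f) (∑-cong E (λ x → ∑-map (allVecs E m) (x ∷_) f))

∑-upTo-suc : (n : ℕ) (h : ℕ → ℤ) → ∑ (upTo (suc n)) h ≡ h 0 + ∑ (upTo n) (h ∘ suc)
∑-upTo-suc n h =
  cong (_+_ (h 0)) (trans (cong (λ xs → ∑ xs h) (sym (List.map-upTo suc n))) (∑-map (upTo n) suc h))

map-≋ : (xs : List A) {f h : A → Mon V} → (∀ x v → f x v ≡ h x v) →
        List.map f xs ≋ List.map h xs
map-≋ {V = V} xs f≗h = Perm.↭-reflexive-≋ (V →-setoid ℤ) (pointwise xs)
  where
  pointwise : ∀ xs → Pointwise (λ m m' → ∀ v → m v ≡ m' v) (List.map _ xs) (List.map _ xs)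
  pointwise []       = []
  pointwise (x ∷ xs) = f≗h x ∷ pointwise xs

∏-at : (xs : List A) (f : A → Mon V) (v : V) → ∏ xs f v ≡ ∑ xs (λ x → f x v)
∏-at []       f v = refl
∏-at (x ∷ xs) f v = cong (_+_ (f x v)) (∏-at xs f v)

-- Summing over E evaluates every function supported on {c} at c; for all c,
-- this says that E lists every element exactly once.
Selects : List A → A → Set
Selects {A} E c = (h : A → ℤ) → (∀ a → a ≢ c → h a ≡ +0) → ∑ E h ≡ h c

Enumerates : List A → Set
Enumerates E = ∀ c → Selects E c

∑-sift : (_≟_ : DecidableEquality A) {E : List A} {c : A} → Selects E c →
         (h : A → ℤ) → ∑ E (λ a → var _≟_ c a * h a) ≡ h c
∑-sift _≟_ {c = c} sel h =
  trans (sel _ (λ a a≢c → cong (_* h a) (var-≢ _≟_ (a≢c ∘ sym))))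
        (trans (cong (_* h c) (var-refl _≟_ c)) (ℤ.*-identityˡ (h c)))

unique-selects : {E : List A} {c : A} → Unique E → c ∈ E → Selects E c
unique-selects {E = x ∷ xs} (x∉xs ∷ _) (here refl) h h0 =
  trans (cong (_+_ (h x)) (vanish xs x∉xs)) (ℤ.+-identityʳ (h x))
  where
  vanish : ∀ ys → All (x ≢_) ys → ∑ ys h ≡ +0
  vanish []       []           = refl
  vanish (y ∷ ys) (x≢y ∷ x∉ys) =
    trans (cong₂ _+_ (h0 y (x≢y ∘ sym)) (vanish ys x∉ys)) (ℤ.+-identityˡ _)
unique-selects {E = x ∷ xs} {c} (x∉xs ∷ unique) (there c∈xs) h h0 =
  trans (cong₂ _+_ (h0 x x≢c) (unique-selects unique c∈xs h h0)) (ℤ.+-identityˡ _)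
  where
  x≢c : x ≢ c
  x≢c refl = All.lookup x∉xs c∈xs refl

allVecs-enumerates : {E : List A} → Enumerates E → ∀ m → Enumerates (allVecs E m)
allVecs-enumerates enum zero    []       h h0 = ℤ.+-identityʳ (h [])
allVecs-enumerates {E = E} enum (suc m) (c ∷ cs) h h0 = begin
  ∑ (allVecs E (suc m)) h                          ≡⟨ ∑-allVecs-suc E m h ⟩
  ∑ E (λ x → ∑ (allVecs E m) (λ xs → h (x ∷ xs)))  ≡⟨ ∑-cong E inner ⟩
  ∑ E (λ x → h (x ∷ cs))
    ≡⟨ enum c _ (λ x x≢c → h0 _ (x≢c ∘ Vec.∷-injectiveˡ)) ⟩
  h (c ∷ cs)                                       ∎
  where
  open ≡-Reasoning
  inner : ∀ x → ∑ (allVecs E m) (λ xs → h (x ∷ xs)) ≡ h (x ∷ cs)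
  inner x = allVecs-enumerates enum m cs _ (λ xs xs≢cs → h0 _ (xs≢cs ∘ Vec.∷-injectiveʳ))

bits : List Bool
bits = true ∷ false ∷ []

bits-enumerates : Enumerates bits
bits-enumerates true  = unique-selects (((λ ()) ∷ []) ∷ [] ∷ []) (here refl)
bits-enumerates false = unique-selects (((λ ()) ∷ []) ∷ [] ∷ []) (there (here refl))

allSubsets : (g : ℕ) → List (Subset g)
allSubsets = allVecs bits

allFinList : (n : ℕ) → List (Fin n)
allFinList n = Vec.toList (Vec.allFin n)

∑-allFinList-const : ∀ n (k : ℤ) → ∑ (allFinList n) (λ _ → k) ≡ + n * k
∑-allFinList-const n k =
  trans (∑-const (allFinList n) k) (cong (λ m → + m * k) (Vec.length-toList (Vec.allFin n)))

allFinList-enumerates : ∀ n → Enumerates (allFinList n)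
allFinList-enumerates n i =
  subst (λ E → Selects E i) (sym (toList-tabulate n (λ j → j)))
        (unique-selects (allFin⁺ n) (∈-allFin i))
  where
  toList-tabulate : ∀ k (f : Fin k → B) → Vec.toList (Vec.tabulate f) ≡ List.tabulate f
  toList-tabulate zero    f = refl
  toList-tabulate (suc k) f = cong (f Fin.zero ∷_) (toList-tabulate k (f ∘ Fin.suc))

upTo-selects : p < n → Selects (upTo n) p
upTo-selects {n = n} p<n = unique-selects (upTo⁺ n) (∈-upTo⁺ p<n)

∑-reindex : (_≟_ : DecidableEquality A) {EA : List A} {EB : List B}
            (f : B → A) (P : A → Bool) (Φ : A → ℤ) →
            Enumerates EB → (∀ b → Selects EA (f b)) → (∀ b → T (P (f b))) →
            (∀ {b b′} → f b ≡ f b′ → b ≡ b′) → (∀ a → T (P a) → Σ B (λ b → f b ≡ a)) →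
            ∑ EA (λ a → when (P a) (Φ a)) ≡ ∑ EB (Φ ∘ f)
∑-reindex {A = A} _≟_ {EA} {EB} f P Φ enumB selA P∘f injective surjective = begin
  ∑ EA (λ a → when (P a) (Φ a))                 ≡⟨ ∑-cong EA fibre ⟩
  ∑ EA (λ a → ∑ EB (λ b → δ (f b) a * Φ a))   ≡⟨ ∑-swap EA EB (λ a b → δ (f b) a * Φ a) ⟩
  ∑ EB (λ b → ∑ EA (λ a → δ (f b) a * Φ a))
    ≡⟨ ∑-cong EB (λ b → ∑-sift _≟_ {EA} (selA b) Φ) ⟩
  ∑ EB (Φ ∘ f)                                  ∎
  where
  open ≡-Reasoning
  δ : A → A → ℤ
  δ = var _≟_
  fibre : ∀ a → when (P a) (Φ a) ≡ ∑ EB (λ b → δ (f b) a * Φ a)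
  fibre a with T? (P a)
  ... | no ¬Pa = trans (when-¬T ¬Pa) (sym (∑-zero EB (λ b → cong (_* Φ a) (var-≢ _≟_ (fb≢a b)))))
    where
    fb≢a : ∀ b → f b ≢ a
    fb≢a b refl = ¬Pa (P∘f b)
  ... | yes Pa with surjective a Pa
  ... | b₀ , refl = trans (when-T (P∘f b₀)) (sym (trans (enumB b₀ _ off) on))
    where
    off : ∀ b → b ≢ b₀ → var _≟_ (f b) (f b₀) * Φ (f b₀) ≡ +0
    off b b≢b₀ = cong (_* Φ (f b₀)) (var-≢ _≟_ (b≢b₀ ∘ injective))
    on : var _≟_ (f b₀) (f b₀) * Φ (f b₀) ≡ Φ (f b₀)
    on = trans (cong (_* Φ (f b₀)) (var-refl _≟_ (f b₀))) (ℤ.*-identityˡ _)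

Tuple : ℕ → Set
Tuple g = Σ ℕ (Vec (Fin g))

_≟ᵗ_ : DecidableEquality (Tuple g)
_≟ᵗ_ = ≡-dec ℕ._≟_ (Vec.≡-dec Fin._≟_)

allTuples : (g : ℕ) → List (Tuple g)
allTuples g = concatMap (λ p → List.map (p ,_) (allVecs (allFinList g) p)) (upTo (suc g))

∑-allTuples : (h : Tuple g → ℤ) →
              ∑ (allTuples g) h
              ≡ ∑ (upTo (suc g)) (λ p → ∑ (allVecs (allFinList g) p) (λ K → h (p , K)))
∑-allTuples {g} h =
  trans (∑-concatMap (upTo (suc g)) (λ p → List.map (p ,_) (allVecs (allFinList g) p)) h)
        (∑-cong (upTo (suc g)) (λ p → ∑-map (allVecs (allFinList g) p) (p ,_) h))

allTuples-selects : {K : Vec (Fin g) p} → p < suc g → Selects (allTuples g) (p , K)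
allTuples-selects {g} {p} {K} p≤g h h0 = begin
  ∑ (allTuples g) h                                                 ≡⟨ ∑-allTuples h ⟩
  ∑ (upTo (suc g)) (λ q → ∑ (allVecs (allFinList g) q) (λ L → h (q , L)))
    ≡⟨ upTo-selects p≤g _ (λ q q≢p →
         ∑-zero (allVecs (allFinList g) q) (λ L → h0 _ (q≢p ∘ ,-injectiveˡ))) ⟩
  ∑ (allVecs (allFinList g) p) (λ L → h (p , L))
    ≡⟨ allVecs-enumerates (allFinList-enumerates g) p K _
         (λ L L≢K → h0 _ (L≢K ∘ ,-injectiveʳ-UIP ℕ.≡-irrelevant)) ⟩
  h (p , K)                                                         ∎
  where open ≡-Reasoning

shift : Tuple g → Tuple (suc g)
shift (p , K) = p , Vec.map Fin.suc K

adjoin₀ : Tuple g → Tuple (suc g)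
adjoin₀ (p , K) = suc p , Fin.zero ∷ Vec.map Fin.suc K

tuple : Subset g → Tuple g
tuple []          = 0 , []
tuple (true ∷ S)  = adjoin₀ (tuple S)
tuple (false ∷ S) = shift (tuple S)

tuple-length< : (S : Subset g) → proj₁ (tuple S) < suc g
tuple-length< []          = ℕ.s≤s ℕ.z≤n
tuple-length< (true ∷ S)  = ℕ.s≤s (tuple-length< S)
tuple-length< (false ∷ S) = ℕ.m≤n⇒m≤1+n (tuple-length< S)

map-suc-injective : {K K′ : Vec (Fin g) p} → Vec.map Fin.suc K ≡ Vec.map Fin.suc K′ → K ≡ K′
map-suc-injective {K = []}    {[]}      _ = refl
map-suc-injective {K = k ∷ K} {k′ ∷ K′} e with Vec.∷-injective e
... | refl , e′ = cong (k ∷_) (map-suc-injective e′)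

shift-injective : {t t′ : Tuple g} → shift t ≡ shift t′ → t ≡ t′
shift-injective {t = p , K} {p′ , K′} e with ,-injectiveˡ e
... | refl = cong (p ,_) (map-suc-injective (,-injectiveʳ-UIP ℕ.≡-irrelevant e))

adjoin₀-injective : {t t′ : Tuple g} → adjoin₀ t ≡ adjoin₀ t′ → t ≡ t′
adjoin₀-injective {t = p , K} {p′ , K′} e with ,-injectiveˡ e
... | refl = cong (p ,_) (map-suc-injective (Vec.∷-injectiveʳ (,-injectiveʳ-UIP ℕ.≡-irrelevant e)))

shift≢adjoin₀ : {t t′ : Tuple g} → shift t ≢ adjoin₀ t′
shift≢adjoin₀ {t = p , K} {p′ , K′} e with ,-injectiveˡ e
shift≢adjoin₀ {t = _ , k ∷ K} e | refl
  with () ← Vec.∷-injectiveˡ (,-injectiveʳ-UIP ℕ.≡-irrelevant e)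

tuple-injective : {S S′ : Subset g} → tuple S ≡ tuple S′ → S ≡ S′
tuple-injective {S = []}        {[]}         _ = refl
tuple-injective {S = true ∷ S}  {true ∷ S′}  e = cong (true ∷_) (tuple-injective (adjoin₀-injective e))
tuple-injective {S = false ∷ S} {false ∷ S′} e = cong (false ∷_) (tuple-injective (shift-injective e))
tuple-injective {S = true ∷ S}  {false ∷ S′} e = ⊥-elim (shift≢adjoin₀ (sym e))
tuple-injective {S = false ∷ S} {true ∷ S′}  e = ⊥-elim (shift≢adjoin₀ e)

module _ (R : FinRing) where
  open Enumerators R using (increasing)

  increasing-shift : (K : Vec (Fin g) p) → increasing (Vec.map Fin.suc K) ≡ increasing K
  increasing-shift []          = refl
  increasing-shift (i ∷ [])    = refl
  increasing-shift (i ∷ j ∷ K) = cong (_ ∧_) (increasing-shift (j ∷ K))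

  increasing-adjoin₀ : (K : Vec (Fin g) p) → increasing (Fin.zero ∷ Vec.map Fin.suc K) ≡ increasing K
  increasing-adjoin₀ []      = refl
  increasing-adjoin₀ (k ∷ K) = increasing-shift (k ∷ K)

  increasing-tail-shifted : (i : Fin (suc g)) (K : Vec (Fin (suc g)) p) → T (increasing (i ∷ K)) →
                            Σ (Vec (Fin g) p) (λ K′ → Vec.map Fin.suc K′ ≡ K)
  increasing-tail-shifted i []               _   = [] , refl
  increasing-tail-shifted i (Fin.suc j ∷ K)  inc
    with K′ , refl ← increasing-tail-shifted (Fin.suc j) K (proj₂ (to T-∧ inc))
    = j ∷ K′ , refl

  tuple-increasing : (S : Subset g) → T (increasing (proj₂ (tuple S)))
  tuple-increasing []          = _
  tuple-increasing (true ∷ S)  = subst T (sym (increasing-adjoin₀ (proj₂ (tuple S)))) (tuple-increasing S)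
  tuple-increasing (false ∷ S) = subst T (sym (increasing-shift (proj₂ (tuple S)))) (tuple-increasing S)

  tuple-surjective : (t : Tuple g) → T (increasing (proj₂ t)) → Σ (Subset g) (λ S → tuple S ≡ t)
  tuple-surjective {zero}  (0 , [])  _ = [] , refl
  tuple-surjective {suc g} (0 , [])  _ with S , e ← tuple-surjective {g} (0 , []) _ = false ∷ S , cong shift e
  tuple-surjective {suc g} (suc p , Fin.zero ∷ K) inc
    with K′ , refl ← increasing-tail-shifted Fin.zero K inc
    with S , e ← tuple-surjective (p , K′) (subst T (increasing-adjoin₀ K′) inc)
    = true ∷ S , cong adjoin₀ e
  tuple-surjective {suc g} (suc p , Fin.suc k ∷ K) inc
    with K′ , refl ← increasing-tail-shifted (Fin.suc k) K inc
    with S , e ← tuple-surjective (suc p , k ∷ K′) (subst T (increasing-shift (k ∷ K′)) inc)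
    = false ∷ S , cong shift e

  ∑-increasing : (Φ : Tuple g → ℤ) →
                 ∑ (allTuples g) (λ t → when (increasing (proj₂ t)) (Φ t))
                 ≡ ∑ (allSubsets g) (Φ ∘ tuple)
  ∑-increasing {g} Φ =
    ∑-reindex _≟ᵗ_ {allTuples g} {allSubsets g} tuple (increasing ∘ proj₂) Φ
      (allVecs-enumerates {E = bits} bits-enumerates g)
      (λ S → allTuples-selects (tuple-length< S)) tuple-increasing tuple-injective tuple-surjective

module _ (R : FinRing) (elements-enumerate : Enumerates (FinRing.elements R)) where
  open FinRing R using (Carrier; _≟_; 0#; elements)
  open Enumerators R

  allWVars-enumerates : Enumerates (allWVars g)
  allWVars-enumerates {g} = allVecs-enumerates elements-enumerate g

  column : Vec (Vec Carrier n) m → Fin n → Vec Carrier m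
  column ws i = Vec.map (λ w → lookup w i) ws

  nc-∑ : (ws : Vec (Vec Carrier n) m) (c : Vec Carrier m) →
         + nc ws c ≡ ∑ (allFinList n) (λ i → var _≟W_ (column ws i) c)
  nc-∑ {n} ws c = trans (∑-count (λ i → column ws i ≟W c) (allFinList n))
                        (∑-cong (allFinList n) (λ i → sym (var-when _≟W_ (column ws i) c)))

  column-restrict : (us : Vec (Vec Carrier n) g) (K : Vec (Fin g) p) (i : Fin n) →
                    column (Vec.map (lookup us) K) i ≡ restrict (column us i) K
  column-restrict us []      i = refl
  column-restrict us (k ∷ K) i =
    cong₂ _∷_ (sym (Vec.lookup-map k (λ w → lookup w i) us)) (column-restrict us K i)

  nc-restrict : (us : Vec (Vec Carrier n) g) (K : Vec (Fin g) p) (L : Vec Carrier p) →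
                + nc (Vec.map (lookup us) K) L
                ≡ ∑ (allFinList n) (λ i → var _≟W_ (restrict (column us i) K) L)
  nc-restrict {n} us K L =
    trans (nc-∑ (Vec.map (lookup us) K) L)
          (∑-cong (allFinList n) (λ i → cong (λ c → var _≟W_ c L) (column-restrict us K i)))

  ⊂Vsupp-allNonzero : (K : Vec (Fin g) p) (a : Vec Carrier g) → ⊂Vsupp K a ≡ allNonzero (restrict a K)
  ⊂Vsupp-allNonzero []      a = refl
  ⊂Vsupp-allNonzero (k ∷ K) a = cong (_ ∧_) (⊂Vsupp-allNonzero K a)

  restrict-zero-≢ : {K : Vec (Fin g) p} {L : Vec Carrier p} →
                    T (1 ≤ᵇ p) → T (allNonzero L) → restrict (replicate g 0#) K ≢ L
  restrict-zero-≢ {g} {K = k ∷ K} {l ∷ L} _ L≠0 e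
    with refl ← trans (sym (Vec.lookup-replicate k 0#)) (Vec.∷-injectiveˡ e) =
    subst (λ z → T (not z ∧ allNonzero L)) (dec-true (0# ≟ 0#) refl) L≠0

  agrees : WVar g → IVar g → ℤ
  agrees c v = var _≟W_ (restrict c (IVar.K v)) (IVar.L v)

  σ₁-exponent : (a : WVar g) (v : IVar g) → σ₁ a v ≡ agrees a v
  σ₁-exponent {g} a (X p K L {p≥1} {_} {L≠0}) with a ≟W replicate g 0#
  ... | yes refl = sym (var-≢ _≟W_ (restrict-zero-≢ p≥1 L≠0))
  ... | no _ with restrict a K ≟W L
  ...   | yes refl rewrite ⊂Vsupp-allNonzero K a | to T-≡ L≠0 = refl
  ...   | no _     rewrite ∧-zeroʳ (⊂Vsupp K a) = refl

  W-monomial : Vec (Vec Carrier n) g → Mon (WVar g)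
  W-monomial us a = + nc us a

  I-monomial : Vec (Vec Carrier n) g → Mon (IVar g)
  I-monomial us v = + nc (Vec.map (lookup us) (IVar.K v)) (IVar.L v)

  σ₁-monomial : (us : Vec (Vec Carrier n) g) (v : IVar g) →
                substMon (allWVars g) σ₁ (W-monomial us) v ≡ I-monomial us v
  σ₁-monomial {n} {g} us v = begin
    substMon (allWVars g) σ₁ (W-monomial us) v
      ≡⟨ ∏-at (allWVars g) (λ a → σ₁ a ^^ W-monomial us a) v ⟩
    ∑ (allWVars g) (λ a → + nc us a * σ₁ a v)
      ≡⟨ ∑-cong (allWVars g) (λ a → cong₂ _*_ (nc-∑ us a) (σ₁-exponent a v)) ⟩
    ∑ (allWVars g) (λ a → ∑ (allFinList n) (λ i → var _≟W_ (column us i) a) * agrees a v)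
      ≡⟨ ∑-cong (allWVars g) (λ a →
           ∑-*ʳ (allFinList n) (agrees a v) (λ i → var _≟W_ (column us i) a)) ⟨
    ∑ (allWVars g) (λ a → ∑ (allFinList n) (λ i → var _≟W_ (column us i) a * agrees a v))
      ≡⟨ ∑-swap (allWVars g) (allFinList n) (λ a i → var _≟W_ (column us i) a * agrees a v) ⟩
    ∑ (allFinList n) (λ i → ∑ (allWVars g) (λ a → var _≟W_ (column us i) a * agrees a v))
      ≡⟨ ∑-cong (allFinList n) (λ i →
           ∑-sift _≟W_ {allWVars g} (allWVars-enumerates (column us i)) (λ a → agrees a v)) ⟩
    ∑ (allFinList n) (λ i → agrees (column us i) v)
      ≡⟨ nc-restrict us (IVar.K v) (IVar.L v) ⟨
    I-monomial us v
      ∎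
    where open ≡-Reasoning

  var-∷ : (x y : Carrier) (xs ys : Vec Carrier g) →
          var _≟W_ (x ∷ xs) (y ∷ ys) ≡ var _≟_ x y * var _≟W_ xs ys
  var-∷ x y xs ys with (x ∷ xs) ≟W (y ∷ ys) | x ≟ y | xs ≟W ys
  ... | yes _  | yes _    | yes _    = refl
  ... | yes e  | no x≢y   | _        = ⊥-elim (x≢y (Vec.∷-injectiveˡ e))
  ... | yes e  | yes _    | no xs≢ys = ⊥-elim (xs≢ys (Vec.∷-injectiveʳ e))
  ... | no _   | no _     | _        = refl
  ... | no _   | yes _    | no _     = refl
  ... | no ≢   | yes refl | yes refl = ⊥-elim (≢ refl)

  σ₂-at : Vec (Fin g) p → Vec Carrier p → WVar g → ℤ
  σ₂-at {p = p} K L b = ∑ (allVecs bits p) (λ s → sign (p ∸ size s) * var _≟W_ (Lsub K L s) b)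

  σ₂-exponent : (v : IVar g) (b : WVar g) → σ₂ v b ≡ σ₂-at (IVar.K v) (IVar.L v) b
  σ₂-exponent (X p K L) b = ∏-at (allVecs bits p) (λ s → var _≟W_ (Lsub K L s) ^^ sign (p ∸ size s)) b

  Lsub-shift : (K : Vec (Fin g) p) (L : Vec Carrier p) (s : Subset p) →
               Lsub (Vec.map Fin.suc K) L s ≡ 0# ∷ Lsub K L s
  Lsub-shift []      []      []          = refl
  Lsub-shift (k ∷ K) (l ∷ L) (true ∷ s)  rewrite Lsub-shift K L s = refl
  Lsub-shift (k ∷ K) (l ∷ L) (false ∷ s) = Lsub-shift K L s

  var-Lsub-shift : (K : Vec (Fin g) p) (L : Vec Carrier p) (s : Subset p) (b₀ : Carrier) (b : WVar g) →
                   var _≟W_ (Lsub (Vec.map Fin.suc K) L s) (b₀ ∷ b)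
                   ≡ var _≟_ 0# b₀ * var _≟W_ (Lsub K L s) b
  var-Lsub-shift K L s b₀ b =
    trans (cong (λ a → var _≟W_ a (b₀ ∷ b)) (Lsub-shift K L s)) (var-∷ 0# b₀ _ b)

  sign-suc-∸ : (s : Subset p) → sign (suc p ∸ size s) ≡ - sign (p ∸ size s)
  sign-suc-∸ {p} s = trans (cong sign (ℕ.+-∸-assoc 1 (size≤ s))) (sign-suc (p ∸ size s))
    where
    size≤ : ∀ {q} (s : Subset q) → size s ℕ.≤ q
    size≤ []          = ℕ.z≤n
    size≤ (true ∷ s)  = ℕ.s≤s (size≤ s)
    size≤ (false ∷ s) = ℕ.m≤n⇒m≤1+n (size≤ s)
    sign-suc : ∀ m → sign (suc m) ≡ - sign m
    sign-suc zero    = refl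
    sign-suc (suc m) = trans (sym (ℤ.neg-involutive (sign m))) (cong -_ (sym (sign-suc m)))

  σ₂-at-shift : (K : Vec (Fin g) p) (L : Vec Carrier p) (b₀ : Carrier) (b : WVar g) →
                σ₂-at (Vec.map Fin.suc K) L (b₀ ∷ b) ≡ var _≟_ 0# b₀ * σ₂-at K L b
  σ₂-at-shift {p = p} K L b₀ b =
    ∑-scale (allVecs bits p) (var _≟_ 0# b₀) {h = λ s → sign (p ∸ size s) * var _≟W_ (Lsub K L s) b}
      λ s →
      trans (cong (sign (p ∸ size s) *_) (var-Lsub-shift K L s b₀ b))
            (x∙yz≈y∙xz (sign (p ∸ size s)) (var _≟_ 0# b₀) _)

  σ₂-at-adjoin₀ : (K : Vec (Fin g) p) (L : Vec Carrier p) (c₀ b₀ : Carrier) (b : WVar g) →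
                  σ₂-at (Fin.zero ∷ Vec.map Fin.suc K) (c₀ ∷ L) (b₀ ∷ b)
                  ≡ (var _≟_ c₀ b₀ - var _≟_ 0# b₀) * σ₂-at K L b
  σ₂-at-adjoin₀ {p = p} K L c₀ b₀ b = begin
    σ₂-at (Fin.zero ∷ Vec.map Fin.suc K) (c₀ ∷ L) (b₀ ∷ b)
      ≡⟨ ∑-allVecs-suc bits p summand ⟩
    ∑ (allVecs bits p) kept + (∑ (allVecs bits p) dropped + +0)
      ≡⟨ cong₂ (λ x y → x + (y + +0)) (∑-scale (allVecs bits p) (var _≟_ c₀ b₀) {h = term} kept≡)
                                      (∑-scale (allVecs bits p) (- var _≟_ 0# b₀) {h = term} dropped≡) ⟩
    var _≟_ c₀ b₀ * σ₂-at K L b + (- var _≟_ 0# b₀ * σ₂-at K L b + +0)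
      ≡⟨ combine (var _≟_ c₀ b₀) (var _≟_ 0# b₀) (σ₂-at K L b) ⟩
    (var _≟_ c₀ b₀ - var _≟_ 0# b₀) * σ₂-at K L b
      ∎
    where
    open ≡-Reasoning
    term : Subset p → ℤ
    term s = sign (p ∸ size s) * var _≟W_ (Lsub K L s) b
    summand : Subset (suc p) → ℤ
    summand s =
      sign (suc p ∸ size s) * var _≟W_ (Lsub (Fin.zero ∷ Vec.map Fin.suc K) (c₀ ∷ L) s) (b₀ ∷ b)
    kept dropped : Subset p → ℤ
    kept    s = summand (true ∷ s)
    dropped s = summand (false ∷ s)
    kept≡ : ∀ s → kept s ≡ var _≟_ c₀ b₀ * term s
    kept≡ s rewrite Lsub-shift K L s | var-∷ c₀ b₀ (Lsub K L s) b =
      x∙yz≈y∙xz (sign (p ∸ size s)) (var _≟_ c₀ b₀) _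
    dropped≡ : ∀ s → dropped s ≡ - var _≟_ 0# b₀ * term s
    dropped≡ s rewrite sign-suc-∸ s | var-Lsub-shift K L s b₀ b =
      negate (sign (p ∸ size s)) (var _≟_ 0# b₀) _
      where
      negate : ∀ a v x → (- a) * (v * x) ≡ (- v) * (a * x)
      negate = solve-∀
    combine : ∀ x y z → x * z + (- y * z + +0) ≡ (x - y) * z
    combine = solve-∀

  -- The ψ of the header; ψ-shift and ψ-adjoin₀ establish its product form.
  ψ : (c b : WVar g) → Tuple g → ℤ
  ψ c b (p , K) = when (allNonzero (restrict c K)) (σ₂-at K (restrict c K) b)

  restrict-shift : (c₀ : Carrier) (c : WVar g) (K : Vec (Fin g) p) →
                   restrict (c₀ ∷ c) (Vec.map Fin.suc K) ≡ restrict c K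
  restrict-shift c₀ c K = sym (Vec.map-∘ (lookup (c₀ ∷ c)) Fin.suc K)

  ψ-shift : (c₀ b₀ : Carrier) (c b : WVar g) (t : Tuple g) →
            ψ (c₀ ∷ c) (b₀ ∷ b) (shift t) ≡ var _≟_ 0# b₀ * ψ c b t
  ψ-shift c₀ b₀ c b (p , K) rewrite restrict-shift c₀ c K =
    trans (cong (when _) (σ₂-at-shift K (restrict c K) b₀ b)) (when-*ʳ _ (var _≟_ 0# b₀) _)

  ψ-adjoin₀ : (c₀ b₀ : Carrier) (c b : WVar g) (t : Tuple g) →
              ψ (c₀ ∷ c) (b₀ ∷ b) (adjoin₀ t)
              ≡ when (not (isZero c₀)) (var _≟_ c₀ b₀ - var _≟_ 0# b₀) * ψ c b t
  ψ-adjoin₀ c₀ b₀ c b (p , K) rewrite restrict-shift c₀ c K =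
    trans (cong (when _) (σ₂-at-adjoin₀ K (restrict c K) c₀ b₀ b))
          (when-∧-* (not (isZero c₀)) _ (var _≟_ c₀ b₀ - var _≟_ 0# b₀) _)

  when-nonzero-+ : (c₀ b₀ : Carrier) →
                   when (not (isZero c₀)) (var _≟_ c₀ b₀ - var _≟_ 0# b₀) + var _≟_ 0# b₀
                   ≡ var _≟_ c₀ b₀
  when-nonzero-+ c₀ b₀ with c₀ ≟ 0#
  ... | yes refl = ℤ.+-identityˡ _
  ... | no _     = cancel (var _≟_ c₀ b₀) (var _≟_ 0# b₀)
    where
    cancel : ∀ x y → x - y + y ≡ x
    cancel = solve-∀

  ∑-ψ : (c b : WVar g) → ∑ (allSubsets g) (ψ c b ∘ tuple) ≡ var _≟W_ c b
  ∑-ψ []       []       = refl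
  ∑-ψ {suc g} (c₀ ∷ c) (b₀ ∷ b) = begin
    ∑ (allSubsets (suc g)) (ψ (c₀ ∷ c) (b₀ ∷ b) ∘ tuple)
      ≡⟨ ∑-allVecs-suc bits g (ψ (c₀ ∷ c) (b₀ ∷ b) ∘ tuple) ⟩
    ∑ (allSubsets g) (ψ (c₀ ∷ c) (b₀ ∷ b) ∘ adjoin₀ ∘ tuple)
      + (∑ (allSubsets g) (ψ (c₀ ∷ c) (b₀ ∷ b) ∘ shift ∘ tuple) + +0)
      ≡⟨ cong₂ (λ x y → x + (y + +0))
           (∑-scale (allSubsets g) δ {h = ψ c b ∘ tuple} (ψ-adjoin₀ c₀ b₀ c b ∘ tuple))
           (∑-scale (allSubsets g) δ₀ {h = ψ c b ∘ tuple} (ψ-shift c₀ b₀ c b ∘ tuple)) ⟩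
    δ * ∑ (allSubsets g) (ψ c b ∘ tuple) + (δ₀ * ∑ (allSubsets g) (ψ c b ∘ tuple) + +0)
      ≡⟨ cong (λ x → δ * x + (δ₀ * x + +0)) (∑-ψ c b) ⟩
    δ * var _≟W_ c b + (δ₀ * var _≟W_ c b + +0)
      ≡⟨ factor δ δ₀ (var _≟W_ c b) ⟩
    (δ + δ₀) * var _≟W_ c b
      ≡⟨ cong (_* var _≟W_ c b) (when-nonzero-+ c₀ b₀) ⟩
    var _≟_ c₀ b₀ * var _≟W_ c b
      ≡⟨ var-∷ c₀ b₀ c b ⟨
    var _≟W_ (c₀ ∷ c) (b₀ ∷ b)
      ∎
    where
    open ≡-Reasoning
    δ δ₀ : ℤ
    δ  = when (not (isZero c₀)) (var _≟_ c₀ b₀ - var _≟_ 0# b₀)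
    δ₀ = var _≟_ 0# b₀
    factor : ∀ x y z → x * z + (y * z + +0) ≡ (x + y) * z
    factor = solve-∀

  maybe-mkIVar : (G : (p : ℕ) → Vec (Fin g) p → Vec Carrier p → ℤ)
                 (K : Vec (Fin g) p) (L : Vec Carrier p) →
                 maybe′ (λ v → G (IVar.p v) (IVar.K v) (IVar.L v)) +0 (mkIVar p K L)
                 ≡ when ((1 ≤ᵇ p) ∧ increasing K ∧ allNonzero L) (G p K L)
  maybe-mkIVar {p = p} G K L with T? (1 ≤ᵇ p) | T? (increasing K) | T? (allNonzero L)
  ... | yes p≥1 | yes inc | yes L≠0 rewrite to T-≡ p≥1 | to T-≡ inc | to T-≡ L≠0 = refl
  ... | yes p≥1 | yes inc | no ¬L≠0 rewrite to T-≡ p≥1 | to T-≡ inc | ¬T⇒≡false ¬L≠0 = refl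
  ... | yes p≥1 | no ¬inc | _       rewrite to T-≡ p≥1 | ¬T⇒≡false ¬inc = refl
  ... | no ¬p≥1 | _       | _       rewrite ¬T⇒≡false ¬p≥1 = refl

  ∑-allIVars : (G : (p : ℕ) → Vec (Fin g) p → Vec Carrier p → ℤ) →
    ∑ (allIVars g) (λ v → G (IVar.p v) (IVar.K v) (IVar.L v))
    ≡ ∑ (upTo (suc g)) (λ p → ∑ (allVecs (allFinList g) p) (λ K → ∑ (allVecs elements p) (λ L →
        when ((1 ≤ᵇ p) ∧ increasing K ∧ allNonzero L) (G p K L))))
  ∑-allIVars {g} G =
    trans (∑-concatMap (upTo (suc g)) ivarsOfLength G′) (∑-cong (upTo (suc g)) λ p →
      trans (∑-concatMap (allVecs (allFinList g) p) (ivarsOn p) G′) (∑-cong (allVecs (allFinList g) p) λ K →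
        trans (∑-mapMaybe (allVecs elements p) (mkIVar p K) G′)
              (∑-cong (allVecs elements p) (maybe-mkIVar G K))))
    where
    G′ : IVar g → ℤ
    G′ v = G (IVar.p v) (IVar.K v) (IVar.L v)
    ivarsOn : (p : ℕ) → Vec (Fin g) p → List (IVar g)
    ivarsOn p K = mapMaybe (mkIVar p K) (allVecs elements p)
    ivarsOfLength : ℕ → List (IVar g)
    ivarsOfLength p = concatMap (ivarsOn p) (allVecs (allFinList g) p)

  column-identity : (c b : WVar g) →
    var _≟W_ (replicate g 0#) b
      + ∑ (allIVars g) (λ v → agrees c v * σ₂ v b)
    ≡ var _≟W_ c b
  column-identity {g} c b = begin
    x₀ + ∑ (allIVars g) (λ v → agrees c v * σ₂ v b)
      ≡⟨ cong (_+_ x₀) (∑-cong (allIVars g) (λ v → cong (agrees c v *_) (σ₂-exponent v b))) ⟩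
    x₀ + ∑ (allIVars g) (λ v → agrees c v * σ₂-at (IVar.K v) (IVar.L v) b)
      ≡⟨ cong (_+_ x₀) (∑-allIVars (λ p K L → var _≟W_ (restrict c K) L * σ₂-at K L b)) ⟩
    x₀ + ∑ (upTo (suc g)) (λ p → ∑ (Ks p) (λ K → ∑ (allVecs elements p) (λ L →
           when ((1 ≤ᵇ p) ∧ increasing K ∧ allNonzero L) (var _≟W_ (restrict c K) L * σ₂-at K L b))))
      ≡⟨ cong (_+_ x₀) (∑-cong (upTo (suc g)) λ p → ∑-cong (Ks p) λ K → sift-L p K) ⟩
    x₀ + ∑ (upTo (suc g)) (λ p → ∑ (Ks p) (λ K → when (1 ≤ᵇ p) (F p K)))
      ≡⟨ cong (_+_ x₀) (∑-upTo-suc g (λ p → ∑ (Ks p) (λ K → when (1 ≤ᵇ p) (F p K)))) ⟩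
    x₀ + ((+0 + +0) + ∑ (upTo g) (λ p → ∑ (Ks (suc p)) (F (suc p))))
      ≡⟨ empty-tuple x₀ (∑ (upTo g) (λ p → ∑ (Ks (suc p)) (F (suc p)))) ⟩
    (F 0 [] + +0) + ∑ (upTo g) (λ p → ∑ (Ks (suc p)) (F (suc p)))
      ≡⟨ ∑-upTo-suc g (λ p → ∑ (Ks p) (F p)) ⟨
    ∑ (upTo (suc g)) (λ p → ∑ (Ks p) (F p))
      ≡⟨ ∑-allTuples (λ t → when (increasing (proj₂ t)) (ψ c b t)) ⟨
    ∑ (allTuples g) (λ t → when (increasing (proj₂ t)) (ψ c b t))
      ≡⟨ ∑-increasing R (ψ c b) ⟩
    ∑ (allSubsets g) (ψ c b ∘ tuple)
      ≡⟨ ∑-ψ c b ⟩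
    var _≟W_ c b
      ∎
    where
    open ≡-Reasoning
    x₀ : ℤ
    x₀ = var _≟W_ (replicate g 0#) b
    Ks : (p : ℕ) → List (Vec (Fin g) p)
    Ks = allVecs (allFinList g)
    F : (p : ℕ) → Vec (Fin g) p → ℤ
    F p K = when (increasing K) (ψ c b (p , K))
    sift-L : ∀ p K → ∑ (allVecs elements p) (λ L → when ((1 ≤ᵇ p) ∧ increasing K ∧ allNonzero L)
                                                        (var _≟W_ (restrict c K) L * σ₂-at K L b))
                     ≡ when (1 ≤ᵇ p) (F p K)
    sift-L p K = begin
      ∑ (allVecs elements p) (λ L → when ((1 ≤ᵇ p) ∧ increasing K ∧ allNonzero L)
                                          (var _≟W_ (restrict c K) L * σ₂-at K L b))
        ≡⟨ ∑-cong (allVecs elements p) (λ L →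
             when-*ʳ ((1 ≤ᵇ p) ∧ increasing K ∧ allNonzero L) (var _≟W_ (restrict c K) L) _) ⟩
      ∑ (allVecs elements p) (λ L → var _≟W_ (restrict c K) L
                                    * when ((1 ≤ᵇ p) ∧ increasing K ∧ allNonzero L) (σ₂-at K L b))
        ≡⟨ ∑-sift _≟W_ {allVecs elements p} (allWVars-enumerates (restrict c K)) _ ⟩
      when ((1 ≤ᵇ p) ∧ increasing K ∧ allNonzero (restrict c K)) (σ₂-at K (restrict c K) b)
        ≡⟨ trans (when-∧ (1 ≤ᵇ p) _ _) (cong (when (1 ≤ᵇ p)) (when-∧ (increasing K) _ _)) ⟩
      when (1 ≤ᵇ p) (F p K)
        ∎
    -- K = ∅ is not an index of any X_{K,L}; its term is exactly the factor x₀.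
    empty-tuple : ∀ x r → x + ((+0 + +0) + r) ≡ ((+ 1 * x + +0) + +0) + r
    empty-tuple = solve-∀

  σ₂-monomial : (us : Vec (Vec Carrier n) g) (b : WVar g) →
    ((var _≟W_ (replicate g 0#) ^^ (+ n))
      · substMon (allIVars g) σ₂ (I-monomial us)) b
    ≡ + nc us b
  σ₂-monomial {n} {g} us b = begin
    + n * x₀ + substMon (allIVars g) σ₂ (I-monomial us) b
      ≡⟨ cong₂ _+_ (sym (∑-allFinList-const n x₀))
                   (∏-at (allIVars g) (λ v → σ₂ v ^^ I-monomial us v) b) ⟩
    ∑ (allFinList n) (λ _ → x₀) + ∑ (allIVars g) (λ v → I-monomial us v * σ₂ v b)
      ≡⟨ cong (_+_ (∑ (allFinList n) (λ _ → x₀))) (∑-cong (allIVars g) split-nc) ⟩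
    ∑ (allFinList n) (λ _ → x₀) + ∑ (allIVars g) (λ v → ∑ (allFinList n) (λ i → term i v))
      ≡⟨ cong (_+_ (∑ (allFinList n) (λ _ → x₀))) (∑-swap (allIVars g) (allFinList n) (λ v i → term i v)) ⟩
    ∑ (allFinList n) (λ _ → x₀) + ∑ (allFinList n) (λ i → ∑ (allIVars g) (term i))
      ≡⟨ ∑-+ (allFinList n) (λ _ → x₀) (λ i → ∑ (allIVars g) (term i)) ⟨
    ∑ (allFinList n) (λ i → x₀ + ∑ (allIVars g) (term i))
      ≡⟨ ∑-cong (allFinList n) (λ i → column-identity (column us i) b) ⟩
    ∑ (allFinList n) (λ i → var _≟W_ (column us i) b)
      ≡⟨ nc-∑ us b ⟨
    + nc us b
      ∎
    where
    open ≡-Reasoning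
    x₀ : ℤ
    x₀ = var _≟W_ (replicate g 0#) b
    term : Fin n → IVar g → ℤ
    term i v = agrees (column us i) v * σ₂ v b
    split-nc : ∀ v → I-monomial us v * σ₂ v b ≡ ∑ (allFinList n) (λ i → term i v)
    split-nc v = trans (cong (_* σ₂ v b) (nc-restrict us (IVar.K v) (IVar.L v)))
                       (sym (∑-*ʳ (allFinList n) (σ₂ v b) (λ i → agrees (column us i) v)))

  W-σ₁≋I : (C : LinearCode R n) (g : ℕ) → substPoly (allWVars g) σ₁ (W C g) ≋ I C g
  W-σ₁≋I C g = subst (_≋ I C g) (List.map-∘ (tuples C g)) (map-≋ (tuples C g) σ₁-monomial)

  x₀ⁿ·I-σ₂≋W : (C : LinearCode R n) (g : ℕ) →
               List.map (λ m → (var _≟W_ (replicate g 0#) ^^ (+ n)) · m) (substPoly (allIVars g) σ₂ (I C g))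
               ≋ W C g
  x₀ⁿ·I-σ₂≋W C g =
    subst (_≋ W C g) (trans (List.map-∘ (tuples C g)) (cong (List.map _) (List.map-∘ (tuples C g))))
          (map-≋ (tuples C g) σ₂-monomial)

enumerates-elements : (𝔯 : Alphabet) → Enumerates (FinRing.elements (ringOf 𝔯))
enumerates-elements (𝔽 F)          c = unique-selects (FiniteField.unique F) (FiniteField.complete F c)
enumerates-elements (ℤ/ (suc k) _)   = allFinList-enumerates (suc k)

theorem3p1 : (𝔯 : Alphabet) (g n : ℕ) → 1 ≤ g → 1 ≤ n →
    (C : LinearCode (ringOf 𝔯) n) →
    let open FinRing (ringOf 𝔯)
        open Enumerators (ringOf 𝔯)
    in (substPoly (allWVars g) σ₁ (W C g) ≋ I C g)
       × (map (λ m → (var _≟W_ (replicate g 0#) ^^ (+ n)) · m)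
              (substPoly (allIVars g) σ₂ (I C g))
          ≋ W C g)
theorem3p1 𝔯 g n _ _ C =
  W-σ₁≋I R enum C g , x₀ⁿ·I-σ₂≋W R enum C g
  where
  R : FinRing
  R = ringOf 𝔯
  enum : Enumerates (FinRing.elements R)
  enum = enumerates-elements 𝔯
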